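{- Let $G$ and $J$ be graphs. If there exists a set $S$ with $S \not\subseteq V(G)$ and $S \not\subseteq V(J)$ such that $S$ is a minimum small common neighbourhood set of $G \vee J$, then $c_H(G \vee J) \leq \Upsilon(G \vee J)$.
   Context: The join $G \vee J$ has vertex set $V(G) \cup V(J)$ (disjoint union) and edge set $E(G) \cup E(J) \cup \{uv : u \in V(G), v \in V(J)\}$. For a graph $H$, $N(v)$ is the open neighbourhood of $v$; a non-empty set $S \subseteq V(H)$ is a small common neighbourhood set of $H$ if $\left|\bigcap_{v\in S} N(v)\right| \le |S|$; $\Upsilon(H)$ is the minimum cardinality of such a set, and a minimum small common neighbourhood set is one of cardinality $\Upsilon(H)$. Hyperopic Cops and Robber on $H$ (each vertex considered to carry a loop, so a player may stay put): the cops first occupy a multiset of vertices, then the robber chooses a vertex. In each round, each cop moves to an adjacent vertex or stays, then the robber moves to an adjacent vertex or stays. The robber always sees all cops. The cops see the robber's position except when the robber's vertex is adjacent to every vertex occupied by a cop, in which case the robber is invisible. The robber is captured when a cop occupies the robber's vertex. $c_H(H)$ is the minimum number of cops that can guarantee capture in finitely many moves. -}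

module Defs where

open import Data.Nat using (ℕ; zero; suc; _+_; _≤_)
open import Data.Bool using (Bool; true; false; if_then_else_; _∧_)
open import Data.Fin using (Fin; splitAt)
open import Data.Fin.Subset using (Subset; _∈_; ∣_∣; Nonempty; ⋂; ⊤)
open import Data.Sum using (_⊎_; inj₁; inj₂)
open import Data.Product using (Σ; ∃; _×_; _,_; proj₁)
open import Data.Maybe using (Maybe; just; nothing)
open import Data.List using (List; []; _∷_; allFin; map; foldr)
open import Data.Vec using (tabulate; lookup)
open import Relation.Binary.PropositionalEquality using (_≡_; refl)

record Graph (n : ℕ) : Set where
  field
    adj    : Fin n → Fin n → Bool
    sym    : ∀ u v → adj u v ≡ adj v u
    irrefl : ∀ v → adj v v ≡ false

open Graph public

-- The join G ∨ J on vertex set Fin (n + m):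
-- vertices i ↑ˡ m come from G, vertices n ↑ʳ j come from J.

joinAdj : ∀ {n m} → Graph n → Graph m → Fin n ⊎ Fin m → Fin n ⊎ Fin m → Bool
joinAdj G J (inj₁ a) (inj₁ b) = adj G a b
joinAdj G J (inj₂ a) (inj₂ b) = adj J a b
joinAdj G J (inj₁ a) (inj₂ b) = true
joinAdj G J (inj₂ a) (inj₁ b) = true

joinAdj-sym : ∀ {n m} (G : Graph n) (J : Graph m) x y →
              joinAdj G J x y ≡ joinAdj G J y x
joinAdj-sym G J (inj₁ a) (inj₁ b) = sym G a b
joinAdj-sym G J (inj₂ a) (inj₂ b) = sym J a b
joinAdj-sym G J (inj₁ a) (inj₂ b) = refl
joinAdj-sym G J (inj₂ a) (inj₁ b) = refl

joinAdj-irrefl : ∀ {n m} (G : Graph n) (J : Graph m) x → joinAdj G J x x ≡ false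
joinAdj-irrefl G J (inj₁ a) = irrefl G a
joinAdj-irrefl G J (inj₂ a) = irrefl J a

_∨G_ : ∀ {n m} → Graph n → Graph m → Graph (n + m)
_∨G_ {n} G J = record
  { adj    = λ u v → joinAdj G J (splitAt n u) (splitAt n v)
  ; sym    = λ u v → joinAdj-sym G J (splitAt n u) (splitAt n v)
  ; irrefl = λ v → joinAdj-irrefl G J (splitAt n v)
  }

-- V(G) and V(J) as subsets of V(G ∨ J)
leftPart : ∀ n m → Subset (n + m)
leftPart n m = tabulate λ v → isLeft (splitAt n v)
  where
  isLeft : Fin n ⊎ Fin m → Bool
  isLeft (inj₁ _) = true
  isLeft (inj₂ _) = false

rightPart : ∀ n m → Subset (n + m)
rightPart n m = tabulate λ v → isRight (splitAt n v)
  where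
  isRight : Fin n ⊎ Fin m → Bool
  isRight (inj₁ _) = false
  isRight (inj₂ _) = true

nbhd : ∀ {n} → Graph n → Fin n → Subset n
nbhd H v = tabulate (adj H v)

commonNbhd : ∀ {n} → Graph n → Subset n → Subset n
commonNbhd {n} H S =
  ⋂ (map (λ v → if lookup S v then nbhd H v else ⊤) (allFin n))

IsSmallCNS : ∀ {n} → Graph n → Subset n → Set
IsSmallCNS H S = Nonempty S × ∣ commonNbhd H S ∣ ≤ ∣ S ∣

IsUpsilon : ∀ {n} → Graph n → ℕ → Set
IsUpsilon H k = (∃ λ S → IsSmallCNS H S × ∣ S ∣ ≡ k)
              × (∀ T → IsSmallCNS H T → k ≤ ∣ T ∣)

IsMinSmallCNS : ∀ {n} → Graph n → Subset n → Set
IsMinSmallCNS H S = IsSmallCNS H S × IsUpsilon H ∣ S ∣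

-- a legal move (every vertex carries a loop)
Step : ∀ {n} → Graph n → Fin n → Fin n → Set
Step H u v = u ≡ v ⊎ adj H u v ≡ true

Positions : ℕ → ℕ → Set
Positions n k = Fin k → Fin n

-- robber at r is invisible iff r is adjacent to every vertex occupied by a cop
allAdjacent : ∀ {n k} → Graph n → Positions n k → Fin n → Bool
allAdjacent {k = k} H C r = foldr _∧_ true (map (λ i → adj H r (C i)) (allFin k))

observe : ∀ {n k} → Graph n → Positions n k → Fin n → Maybe (Fin n)
observe H C r = if allAdjacent H C r then nothing else just r

-- A (deterministic) cop strategy: initial placement, and a move rule
-- depending on the current cop positions and the observation history
-- (newest observation first).
record CopStrategy {n : ℕ} (H : Graph n) (k : ℕ) : Set where
  field
    start : Positions n k
    next  : Positions n k → List (Maybe (Fin n)) → Positions n k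
    legal : ∀ C h i → Step H (C i) (next C h i)

open CopStrategy public

-- the play against a robber walk R: at time t, the cop positions after
-- the robber's t-th move (time 0: initial placement) and the history.
-- Observations are made after each cops' move and after each robber move.
play : ∀ {n k} {H : Graph n} → CopStrategy H k → (ℕ → Fin n) → ℕ →
       Positions n k × List (Maybe (Fin n))
play {H = H} σ R zero = start σ , (observe H (start σ) (R zero) ∷ [])
play {H = H} σ R (suc t) with play σ R t
... | C , h = C′ , (observe H C′ (R (suc t)) ∷ observe H C′ (R t) ∷ h)
  where C′ = next σ C h

copsAt : ∀ {n k} {H : Graph n} → CopStrategy H k → (ℕ → Fin n) → ℕ → Positions n k
copsAt σ R t = proj₁ (play σ R t)

-- capture: some cop on the robber's vertex, either after the robber's
-- t-th move (or initial placement) or after the cops' (t+1)-th move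
Captured : ∀ {n k} {H : Graph n} → CopStrategy H k → (ℕ → Fin n) → Set
Captured σ R = ∃ λ t → (∃ λ i → copsAt σ R t i ≡ R t)
                     ⊎ (∃ λ i → copsAt σ R (suc t) i ≡ R t)

RobberWalk : ∀ {n} → Graph n → (ℕ → Fin n) → Set
RobberWalk H R = ∀ t → Step H (R t) (R (suc t))

CopsWin : ∀ {n} → Graph n → ℕ → Set
CopsWin H k = Σ (CopStrategy H k) λ σ → ∀ R → RobberWalk H R → Captured σ R

HyperopicCopNumber≤ : ∀ {n} → Graph n → ℕ → Set
HyperopicCopNumber≤ H k = ∃ λ j → j ≤ k × CopsWin H j

-- Let S be a minimum small common neighbourhood set of G ∨ J meeting both V(G) and V(J).
-- Every vertex of the join is adjacent to the vertices of S on the other side, so S is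
-- totally dominating. Place one cop on each vertex of S, i.e. Υ cops. A visible robber is
-- then adjacent to some cop and is captured by the cops' first move. An invisible robber
-- lies in the common neighbourhood of S; it has at most |S| vertices, each adjacent to
-- every cop, so in their first move the cops can occupy all of them.
module Submission where

open import Defs

open import Data.Bool using (Bool; true; false; if_then_else_)
import Data.Bool as Bool
open import Data.Bool.Properties using (T-≡)
open import Data.Fin using (Fin; zero; suc; splitAt; inject≤; _≟_)
open import Data.Fin.Properties using (¬∀⟶∃¬)
open import Data.Fin.Subset using (Subset; _∈_; _∉_; _⊈_; ∣_∣; ⋂; ⊤)
open import Data.Fin.Subset.Properties using (_∈?_; ∈⊤; x∈p∩q⁺)
open import Data.List using (List; []; _∷_; allFin)
open import Data.List.Membership.Propositional.Properties using (∈-allFin)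
open import Data.List.Relation.Unary.All as All using (All; []; _∷_; universal)
open import Data.List.Relation.Unary.All.Properties using (map⁺; all⁺)
open import Data.Maybe using (Maybe; just; nothing)
open import Data.Nat using (ℕ; _+_; _≤_; s≤s)
open import Data.Nat.Properties using (≤-reflexive; ≤-antisym)
open import Data.Product using (Σ; ∃; _×_; _,_; proj₁; proj₂)
open import Data.Sum using (inj₁; inj₂)
open import Data.Vec using (Vec; _∷_; here; there; lookup; tabulate; padRight)
open import Data.Vec.Properties using (lookup⇒[]=; lookup∘tabulate)
open import Function.Base using (_∘_; _∋_)
open import Function.Bundles using (Equivalence)
open import Relation.Nullary using (Dec; yes; no; contradiction)
open import Relation.Nullary.Decidable using (_⊎-dec_; _→-dec_; decidable-stable)
open import Relation.Binary.PropositionalEquality using (_≡_; refl; trans; cong; subst)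

private
  variable
    n m : ℕ

lookup-padRight-inject≤ : ∀ {A : Set} {k l} (k≤l : k ≤ l) (a : A) (xs : Vec A k) i →
                          lookup (padRight k≤l a xs) (inject≤ i k≤l) ≡ lookup xs i
lookup-padRight-inject≤ (s≤s k≤l) a (x ∷ xs) zero    = refl
lookup-padRight-inject≤ (s≤s k≤l) a (x ∷ xs) (suc i) = lookup-padRight-inject≤ k≤l a xs i

enum : (S : Subset n) → Fin ∣ S ∣ → Fin n
enum (true  ∷ S) zero    = zero
enum (true  ∷ S) (suc i) = suc (enum S i)
enum (false ∷ S) i       = suc (enum S i)

enum-∈ : (S : Subset n) (i : Fin ∣ S ∣) → enum S i ∈ S
enum-∈ (true  ∷ S) zero    = here
enum-∈ (true  ∷ S) (suc i) = there (enum-∈ S i)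
enum-∈ (false ∷ S) i       = there (enum-∈ S i)

enum-surjective : (S : Subset n) {x : Fin n} → x ∈ S → ∃ λ i → enum S i ≡ x
enum-surjective (true  ∷ S) here      = zero , refl
enum-surjective (true  ∷ S) (there p) with enum-surjective S p
... | i , refl = suc i , refl
enum-surjective (false ∷ S) (there p) with enum-surjective S p
... | i , refl = i , refl

⊈⇒∃∉ : {p q : Subset n} → p ⊈ q → ∃ λ x → x ∈ p × x ∉ q
⊈⇒∃∉ {n} {p} {q} p⊈q
  with ¬∀⟶∃¬ n (λ x → x ∈ p → x ∈ q) (λ x → x ∈? p →-dec x ∈? q) (λ p⊆q → p⊈q (p⊆q _))
... | x , x∈p↛x∈q =
  x , decidable-stable (x ∈? p) (λ x∉p → x∈p↛x∈q (λ x∈p → contradiction x∈p x∉p))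
    , λ x∈q → x∈p↛x∈q (λ _ → x∈q)

∈-tabulate⁺ : (f : Fin n → Bool) {x : Fin n} → f x ≡ true → x ∈ tabulate f
∈-tabulate⁺ f {x} fx = lookup⇒[]= x _ (trans (lookup∘tabulate f x) fx)

∈-⋂⁺ : {x : Fin n} {ps : List (Subset n)} → All (x ∈_) ps → x ∈ ⋂ ps
∈-⋂⁺ []           = ∈⊤
∈-⋂⁺ (x∈p ∷ x∈ps) = x∈p∩q⁺ (x∈p , ∈-⋂⁺ x∈ps)

∈-commonNbhd⁺ : (H : Graph n) (S : Subset n) {x : Fin n} →
                (∀ {v} → v ∈ S → adj H v x ≡ true) → x ∈ commonNbhd H S
∈-commonNbhd⁺ {n} H S {x} adjS = ∈-⋂⁺ (map⁺ (universal guarded (allFin n)))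
  where
  guarded : ∀ v → x ∈ (if lookup S v then nbhd H v else ⊤)
  guarded v with lookup S v in v∈S
  ... | true  = ∈-tabulate⁺ (adj H v) (adjS (lookup⇒[]= v S v∈S))
  ... | false = ∈⊤

IsTotalDominating : Graph n → Subset n → Set
IsTotalDominating H S = ∀ r → ∃ λ v → v ∈ S × adj H v r ≡ true

IsUpsilon-unique : (H : Graph n) {j k : ℕ} → IsUpsilon H j → IsUpsilon H k → j ≡ k
IsUpsilon-unique H ((S , smallS , ∣S∣≡j) , j≤) ((T , smallT , ∣T∣≡k) , k≤) =
  ≤-antisym (subst (_ ≤_) ∣T∣≡k (j≤ T smallT)) (subst (_ ≤_) ∣S∣≡j (k≤ S smallS))

-- `leftPart` tabulates a function local to Defs that cannot be named; ascribing the type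
-- of `lookup∘tabulate` exposes its application to `splitAt n x` for `with` to abstract.
splitAt≡inj₁⇒∈leftPart : {x : Fin (n + m)} {a : Fin n} →
                          splitAt n x ≡ inj₁ a → x ∈ leftPart n m
splitAt≡inj₁⇒∈leftPart {n} {m} {x} eq
  with splitAt n x | (lookup (leftPart n m) x ≡ _ ∋ lookup∘tabulate _ x)
splitAt≡inj₁⇒∈leftPart {x = x} refl | inj₁ _ | isLeft = lookup⇒[]= x _ isLeft

splitAt≡inj₂⇒∈rightPart : {x : Fin (n + m)} {b : Fin m} →
                           splitAt n x ≡ inj₂ b → x ∈ rightPart n m
splitAt≡inj₂⇒∈rightPart {n} {m} {x} eq
  with splitAt n x | (lookup (rightPart n m) x ≡ _ ∋ lookup∘tabulate _ x)
splitAt≡inj₂⇒∈rightPart {x = x} refl | inj₂ _ | isRight = lookup⇒[]= x _ isRight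

∉leftPart⇒splitAt≡inj₂ : {x : Fin (n + m)} → x ∉ leftPart n m →
                          ∃ λ b → splitAt n x ≡ inj₂ b
∉leftPart⇒splitAt≡inj₂ {n} {x = x} x∉L with splitAt n x in eq
... | inj₁ _ = contradiction (splitAt≡inj₁⇒∈leftPart eq) x∉L
... | inj₂ b = b , refl

∉rightPart⇒splitAt≡inj₁ : {x : Fin (n + m)} → x ∉ rightPart n m →
                           ∃ λ a → splitAt n x ≡ inj₁ a
∉rightPart⇒splitAt≡inj₁ {n} {x = x} x∉R with splitAt n x in eq
... | inj₁ a = a , refl
... | inj₂ _ = contradiction (splitAt≡inj₂⇒∈rightPart eq) x∉R

module _ (G : Graph n) (J : Graph m) where

  ∨G-adj-across : {u v : Fin (n + m)} {a : Fin n} {b : Fin m} →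
                  splitAt n u ≡ inj₁ a → splitAt n v ≡ inj₂ b →
                  adj (G ∨G J) u v ≡ true × adj (G ∨G J) v u ≡ true
  ∨G-adj-across {u = u} {v} eu ev with splitAt n u | splitAt n v
  ∨G-adj-across refl refl | inj₁ _ | inj₂ _ = refl , refl

  ∨G-totalDominating : {S : Subset (n + m)} → S ⊈ leftPart n m → S ⊈ rightPart n m →
                       IsTotalDominating (G ∨G J) S
  ∨G-totalDominating {S} S⊈L S⊈R r = bySide (splitAt n r) refl
    where
    bySide : ∀ s → splitAt n r ≡ s → ∃ λ v → v ∈ S × adj (G ∨G J) v r ≡ true
    bySide (inj₁ _) er =
      let x , x∈S , x∉L = ⊈⇒∃∉ S⊈L
      in  x , x∈S , proj₂ (∨G-adj-across er (proj₂ (∉leftPart⇒splitAt≡inj₂ x∉L)))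
    bySide (inj₂ _) er =
      let y , y∈S , y∉R = ⊈⇒∃∉ S⊈R
      in  y , y∈S , proj₁ (∨G-adj-across (proj₂ (∉rightPart⇒splitAt≡inj₁ y∉R)) er)

step? : (H : Graph n) (u v : Fin n) → Dec (Step H u v)
step? H u v = u ≟ v ⊎-dec adj H u v Bool.≟ true

approach : Graph n → Fin n → Maybe (Fin n) → Fin n
approach H u nothing = u
approach H u (just v) with step? H u v
... | yes _ = v
... | no  _ = u

approach-legal : (H : Graph n) (u : Fin n) (t : Maybe (Fin n)) → Step H u (approach H u t)
approach-legal H u nothing = inj₁ refl
approach-legal H u (just v) with step? H u v
... | yes u→v = u→v
... | no  _   = inj₁ refl

approach-adj : (H : Graph n) {u v : Fin n} → adj H u v ≡ true → approach H u (just v) ≡ v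
approach-adj H {u} {v} uv with step? H u v
... | yes _   = refl
... | no  u↛v = contradiction (inj₂ uv) u↛v

observe≡just⇒≡ : ∀ {k} (H : Graph n) (C : Positions n k) {r x : Fin n} →
                 observe H C r ≡ just x → x ≡ r
observe≡just⇒≡ H C {r} eq with allAdjacent H C r
observe≡just⇒≡ H C refl | false = refl

observe≡nothing⇒adj : ∀ {k} (H : Graph n) (C : Positions n k) {r : Fin n} →
                      observe H C r ≡ nothing → ∀ i → adj H r (C i) ≡ true
observe≡nothing⇒adj {k = k} H C {r} eq i with allAdjacent H C r in allAdj
observe≡nothing⇒adj {k = k} H C {r} refl i | true =
  Equivalence.to T-≡ (All.lookup (all⁺ _ (allFin k) (Equivalence.from T-≡ allAdj)) (∈-allFin i))

module OneRoundCapture (H : Graph n) (S : Subset n)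
                       (fewCommon : ∣ commonNbhd H S ∣ ≤ ∣ S ∣) where

  -- cop `inject≤ j` guards the j-th common neighbour of S; the remaining cops guard nothing
  guard : Fin ∣ S ∣ → Maybe (Fin n)
  guard = lookup (padRight fewCommon nothing (tabulate (just ∘ enum (commonNbhd H S))))

  guard-inject≤ : ∀ j → guard (inject≤ j fewCommon) ≡ just (enum (commonNbhd H S) j)
  guard-inject≤ j = trans (lookup-padRight-inject≤ fewCommon nothing _ j) (lookup∘tabulate _ j)

  target : List (Maybe (Fin n)) → Fin ∣ S ∣ → Maybe (Fin n)
  target (just r ∷ _) _ = just r
  target _            i = guard i

  strategy : CopStrategy H ∣ S ∣
  strategy = record
    { start = enum S
    ; next  = λ C h i → approach H (C i) (target h i)
    ; legal = λ C h i → approach-legal H (C i) (target h i)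
    }

  invisible⇒adj : {r v : Fin n} → observe H (enum S) r ≡ nothing → v ∈ S → adj H v r ≡ true
  invisible⇒adj {r} invisible v∈S with enum-surjective S v∈S
  ... | i , refl = trans (Graph.sym H _ r) (observe≡nothing⇒adj H (enum S) invisible i)

  firstMove-captures : IsTotalDominating H S → ∀ r o → observe H (enum S) r ≡ o →
                       ∃ λ i → approach H (enum S i) (target (o ∷ []) i) ≡ r
  firstMove-captures dominating r (just x) visible
    with observe≡just⇒≡ H (enum S) visible
  ... | refl with dominating r
  ...   | v , v∈S , vr with enum-surjective S v∈S
  ...     | i , refl = i , approach-adj H vr
  firstMove-captures dominating r nothing invisible
    with enum-surjective (commonNbhd H S) (∈-commonNbhd⁺ H S (invisible⇒adj invisible))
  ... | j , refl =
    inject≤ j fewCommon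
    , trans (cong (approach H _) (guard-inject≤ j))
            (approach-adj H (invisible⇒adj invisible (enum-∈ S _)))

  captures : IsTotalDominating H S → ∀ R → Captured strategy R
  captures dominating R =
    0 , inj₂ (firstMove-captures dominating (R 0) (observe H (enum S) (R 0)) refl)

theorem4p3 : {n m : ℕ} (G : Graph n) (J : Graph m) →
    Σ (Subset (n Data.Nat.+ m)) (λ S → (S ⊈ leftPart n m) × (S ⊈ rightPart n m) × IsMinSmallCNS (G ∨G J) S) →
    (k : ℕ) → IsUpsilon (G ∨G J) k → HyperopicCopNumber≤ (G ∨G J) k
theorem4p3 G J (S , S⊈L , S⊈R , (_ , fewCommon) , Υ≡∣S∣) k Υ≡k =
  ∣ S ∣ , ≤-reflexive (IsUpsilon-unique (G ∨G J) Υ≡∣S∣ Υ≡k)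
        , strategy , λ R _ → captures (∨G-totalDominating G J S⊈L S⊈R) R
  where open OneRoundCapture (G ∨G J) S fewCommon
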